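{- For any $q\in\mathbb{C}$, the following identity holds in $\mathcal{H}_n(q)$: $$\mathcal{B}_n(q)\,\mathcal{R}_n(q)=\big(q\,\mathcal{R}_{n-1}(q)+[n]_q+q^nJ_n(q)\big)\,\mathcal{B}_n(q).$$
   Context: $\mathcal{H}_n(q)$ is the Type A Iwahori–Hecke algebra over $\mathbb{C}$ with generators $T_{s_1},\dots,T_{s_{n-1}}$ and relations $T_{s_i}^2=(q-1)T_{s_i}+q$, $T_{s_i}T_{s_j}=T_{s_j}T_{s_i}$ for $|i-j|\ge2$, $T_{s_i}T_{s_{i+1}}T_{s_i}=T_{s_{i+1}}T_{s_i}T_{s_{i+1}}$; it has basis $T_w$ ($w\in\mathfrak{S}_n$), $T_w=T_{s_{i_1}}\cdots T_{s_{i_\ell}}$ for any reduced word of $w$. $\mathcal{H}_{n-1}(q)\subseteq\mathcal{H}_n(q)$ via $T_{s_i}\mapsto T_{s_i}$. $\mathcal{B}_m(q)=\sum_{i=1}^{m}T_{s_{m-1}}\cdots T_{s_i}$, $\mathcal{B}^*_m(q)=\sum_{j=1}^{m}T_{s_j}\cdots T_{s_{m-1}}$ (empty products equal $1$), $\mathcal{R}_m(q)=\mathcal{B}^*_m(q)\mathcal{B}_m(q)$. $[n]_q=1+q+\dots+q^{n-1}$. The Jucys–Murphy element is $J_n(q)=\sum_{i=1}^{n-1}q^{i-n}T_{(i,n)}$ for $q\ne0$, where $(i,n)$ is a transposition; thus $q^nJ_n(q)=\sum_{i=1}^{n-1}q^{i}T_{(i,n)}$, which is defined for all $q\in\mathbb{C}$.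 -}

module Defs where

open import Level using (Level)
open import Data.Nat using (ℕ; zero; suc; _∸_) renaming (_+_ to _+ℕ_)
open import Algebra.Bundles using (CommutativeRing; Ring)

-- Definitions for the Iwahori–Hecke algebra identity, inside an arbitrary
-- ring A (playing the role of a K-algebra via ι : K → A) with chosen
-- elements T i standing for the generators T_{s_i}.
module Hecke {c ℓ c' ℓ' : Level}
  (K : CommutativeRing c ℓ) (A : Ring c' ℓ')
  (ι : CommutativeRing.Carrier K → Ring.Carrier A)
  (q : CommutativeRing.Carrier K)
  (T : ℕ → Ring.Carrier A) where

  private
    module K = CommutativeRing K
  open Ring A

  qpow : ℕ → K.Carrier
  qpow zero    = K.1#
  qpow (suc k) = q K.* qpow k

  qint : ℕ → K.Carrier
  qint zero    = K.0#
  qint (suc n) = qint n K.+ qpow n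

  sum1 : ℕ → (ℕ → Carrier) → Carrier
  sum1 zero    f = 0#
  sum1 (suc m) f = sum1 m f + f (suc m)

  desc : ℕ → ℕ → Carrier
  desc i zero    = 1#
  desc i (suc k) = T (i +ℕ k) * desc i k

  asc : ℕ → ℕ → Carrier
  asc i zero    = 1#
  asc i (suc k) = T i * asc (suc i) k

  B : ℕ → Carrier
  B m = sum1 m (λ i → desc i (m ∸ i))

  B* : ℕ → Carrier
  B* m = sum1 m (λ j → asc j (m ∸ j))

  R : ℕ → Carrier
  R m = B* m * B m

  -- T_{(i,n)} via the reduced word s_i ⋯ s_{n-2} s_{n-1} s_{n-2} ⋯ s_i
  Ttrans : ℕ → ℕ → Carrier
  Ttrans i n = asc i (n ∸ suc i) * T (n ∸ 1) * desc i (n ∸ suc i)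

  -- q^n J_n(q) = Σ_{i=1}^{n-1} q^i T_{(i,n)}
  qnJ : ℕ → Carrier
  qnJ n = sum1 (n ∸ 1) (λ i → ι (qpow i) * Ttrans i n)

-- With t = T_m, B_{m+1} = t B_m + 1 and B*_{m+1} = B*_m t + 1.  Induction on m gives
--   (1) B_{m+1} B*_{m+1} = [m+1]_q + q^{m+1} J_{m+1} + B*_m T_m B_m,
--   (2) T_m B_m B_{m+1} = q B_m B_{m+1},
-- and the identity follows by multiplying (1) on the right by B_{m+1}, since by (2)
-- B*_m T_m B_m B_{m+1} = q R_m B_{m+1}.  For (1), conjugating the inductive hypothesis
-- by t turns q^m J_m into q^{m+1} J_{m+1} - q^m t, the braid relation matches the
-- remaining words, and t [m]_q t = [m]_q ((q-1) t + q) supplies the scalars.  For (2),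
-- t (t + 1) = q (t + 1) and the braid relation reduce it to (2) for m - 1.
module Submission where

open import Defs
open import Level using (Level; _⊔_)
open import Data.Nat using (ℕ; zero; suc; _≤_; _<_; _∸_; ∣_-_∣; z≤n; s≤s)
  renaming (_+_ to _+ℕ_)
import Data.Nat.Properties as ℕ
open import Algebra.Bundles using (CommutativeRing; Ring)
open import Algebra.Morphism.Structures using (IsRingHomomorphism)
import Algebra.Properties.CommutativeSemigroup as CommutativeSemigroupProperties
import Algebra.Properties.Ring as RingProperties
import Algebra.Solver.CommutativeMonoid as CommutativeMonoidSolver
open import Relation.Binary.PropositionalEquality as ≡ using (_≡_)
import Relation.Binary.Reasoning.Setoid as SetoidReasoning
open import Tactic.MonoidSolver using (solve)

module NoncommutativeRing {c ℓ} (A : Ring c ℓ) where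
  open Ring A
  open SetoidReasoning setoid

  Commute : Carrier → Carrier → Set ℓ
  Commute x y = x * y ≈ y * x

  commute-respʳ : ∀ {x y z} → y ≈ z → Commute x y → Commute x z
  commute-respʳ y≈z xy≈yx = trans (*-congˡ (sym y≈z)) (trans xy≈yx (*-congʳ y≈z))

  commute-0# : ∀ x → Commute x 0#
  commute-0# x = trans (zeroʳ x) (sym (zeroˡ x))

  commute-1# : ∀ x → Commute x 1#
  commute-1# x = trans (*-identityʳ x) (sym (*-identityˡ x))

  commute-+ : ∀ {x y z} → Commute x y → Commute x z → Commute x (y + z)
  commute-+ {x} {y} {z} xy≈yx xz≈zx = begin
    x * (y + z)   ≈⟨ distribˡ x y z ⟩
    x * y + x * z ≈⟨ +-cong xy≈yx xz≈zx ⟩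
    y * x + z * x ≈⟨ distribʳ x y z ⟨
    (y + z) * x   ∎

  commute-* : ∀ {x y z} → Commute x y → Commute x z → Commute x (y * z)
  commute-* {x} {y} {z} xy≈yx xz≈zx = begin
    x * (y * z) ≈⟨ *-assoc x y z ⟨
    (x * y) * z ≈⟨ *-congʳ xy≈yx ⟩
    (y * x) * z ≈⟨ *-assoc y x z ⟩
    y * (x * z) ≈⟨ *-congˡ xz≈zx ⟩
    y * (z * x) ≈⟨ *-assoc y z x ⟨
    (y * z) * x ∎

  commute-swap : ∀ {x y} z → Commute x y → x * (y * z) ≈ y * (x * z)
  commute-swap {x} {y} z xy≈yx = begin
    x * (y * z) ≈⟨ *-assoc x y z ⟨
    (x * y) * z ≈⟨ *-congʳ xy≈yx ⟩
    (y * x) * z ≈⟨ *-assoc y x z ⟩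
    y * (x * z) ∎

  -- The braid relation is only assumed after left multiplication by a, so that
  -- a = 0 needs no braid relation (T_0 is not a generator).
  braid-sandwich : ∀ {a t u d} → Commute u a → Commute u d →
                   a * ((t * u) * t) ≈ a * ((u * t) * u) →
                   ((a * t) * u) * (t * d) ≈ (u * ((a * t) * d)) * u
  braid-sandwich {a} {t} {u} {d} ua≈au ud≈du braid = begin
    ((a * t) * u) * (t * d) ≈⟨ solve *-monoid ⟩
    (a * ((t * u) * t)) * d ≈⟨ *-congʳ braid ⟩
    (a * ((u * t) * u)) * d ≈⟨ solve *-monoid ⟩
    (a * u) * (t * (u * d)) ≈⟨ *-cong (sym ua≈au) (*-congˡ ud≈du) ⟩
    (u * a) * (t * (d * u)) ≈⟨ solve *-monoid ⟩
    (u * ((a * t) * d)) * u ∎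

  sandwich-distrib : ∀ t x y → (t * (x + y)) * t ≈ (t * x) * t + (t * y) * t
  sandwich-distrib t x y = trans (*-congʳ (distribˡ t x y)) (distribʳ t (t * x) (t * y))

  +1-product-expansion : ∀ t x y →
    (t * y + 1#) * (x * t + 1#) ≈ ((t * (y * x)) * t + (t * y + x * t)) + 1#
  +1-product-expansion t x y = begin
    (t * y + 1#) * (x * t + 1#)
      ≈⟨ distribʳ _ _ _ ⟩
    (t * y) * (x * t + 1#) + 1# * (x * t + 1#)
      ≈⟨ +-cong (distribˡ _ _ _) (*-identityˡ _) ⟩
    ((t * y) * (x * t) + (t * y) * 1#) + (x * t + 1#)
      ≈⟨ +-congʳ (+-cong regroup (*-identityʳ _)) ⟩
    ((t * (y * x)) * t + t * y) + (x * t + 1#)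
      ≈⟨ +-assoc _ _ _ ⟩
    (t * (y * x)) * t + (t * y + (x * t + 1#))
      ≈⟨ +-congˡ (+-assoc _ _ _) ⟨
    (t * (y * x)) * t + ((t * y + x * t) + 1#)
      ≈⟨ +-assoc _ _ _ ⟨
    ((t * (y * x)) * t + (t * y + x * t)) + 1# ∎
    where
    regroup : (t * y) * (x * t) ≈ (t * (y * x)) * t
    regroup = solve *-monoid

  +1-sandwich-expansion : ∀ t x y →
    ((x + 1#) * t) * (y + 1#) + t ≈ (x * t) * y + (t * (y + 1#) + (x + 1#) * t)
  +1-sandwich-expansion t x y = begin
    ((x + 1#) * t) * (y + 1#) + t
      ≈⟨ +-congʳ (*-congʳ (trans (distribʳ t x 1#) (+-congˡ (*-identityˡ t)))) ⟩
    (x * t + t) * (y + 1#) + t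
      ≈⟨ +-congʳ (distribʳ _ _ _) ⟩
    ((x * t) * (y + 1#) + t * (y + 1#)) + t
      ≈⟨ +-congʳ (+-congʳ (trans (distribˡ _ y 1#) (+-congˡ (*-identityʳ _)))) ⟩
    (((x * t) * y + x * t) + t * (y + 1#)) + t
      ≈⟨ +-assoc _ _ _ ⟩
    ((x * t) * y + x * t) + (t * (y + 1#) + t)
      ≈⟨ +-assoc _ _ _ ⟩
    (x * t) * y + (x * t + (t * (y + 1#) + t))
      ≈⟨ +-congˡ (x∙yz≈y∙xz _ _ _) ⟩
    (x * t) * y + (t * (y + 1#) + (x * t + t))
      ≈⟨ +-congˡ (+-congˡ (trans (distribʳ t x 1#) (+-congˡ (*-identityˡ t)))) ⟨
    (x * t) * y + (t * (y + 1#) + (x + 1#) * t) ∎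
    where open CommutativeSemigroupProperties +-commutativeSemigroup using (x∙yz≈y∙xz)

module HeckeProperties {c ℓ c' ℓ' : Level} (K : CommutativeRing c ℓ) (A : Ring c' ℓ')
  (ι : CommutativeRing.Carrier K → Ring.Carrier A)
  (q : CommutativeRing.Carrier K) (T : ℕ → Ring.Carrier A) where

  open Hecke K A ι q T
  private module K = CommutativeRing K

  module _ where
    open CommutativeRing K
    open SetoidReasoning setoid

    q-1+1≈q : (q - 1#) + 1# ≈ q
    q-1+1≈q = begin
      (q + - 1#) + 1# ≈⟨ +-assoc q (- 1#) 1# ⟩
      q + (- 1# + 1#) ≈⟨ +-congˡ (-‿inverseˡ 1#) ⟩
      q + 0#          ≈⟨ +-identityʳ q ⟩
      q               ∎

    qpow≈qint*[q-1]+1 : ∀ k → qpow k ≈ qint k * (q - 1#) + 1#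
    qpow≈qint*[q-1]+1 zero = sym (trans (+-congʳ (zeroˡ (q - 1#))) (+-identityˡ 1#))
    qpow≈qint*[q-1]+1 (suc k) = begin
      q * qpow k                                       ≈⟨ *-comm q (qpow k) ⟩
      qpow k * q                                       ≈⟨ *-congˡ (trans (+-comm _ _) q-1+1≈q) ⟨
      qpow k * (1# + (q - 1#))                         ≈⟨ distribˡ (qpow k) 1# (q - 1#) ⟩
      qpow k * 1# + qpow k * (q - 1#)                  ≈⟨ +-congʳ (*-identityʳ (qpow k)) ⟩
      qpow k + qpow k * (q - 1#)                       ≈⟨ +-congʳ (qpow≈qint*[q-1]+1 k) ⟩
      (qint k * (q - 1#) + 1#) + qpow k * (q - 1#)     ≈⟨ xy∙z≈xz∙y _ _ _ ⟩
      (qint k * (q - 1#) + qpow k * (q - 1#)) + 1#     ≈⟨ +-congʳ (distribʳ (q - 1#) (qint k) (qpow k)) ⟨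
      (qint k + qpow k) * (q - 1#) + 1#                ∎
      where open CommutativeSemigroupProperties +-commutativeSemigroup using (xy∙z≈xz∙y)

    qint-suc≈qint*q+1 : ∀ k → qint (suc k) ≈ qint k * q + 1#
    qint-suc≈qint*q+1 k = begin
      qint k + qpow k                          ≈⟨ +-congˡ (qpow≈qint*[q-1]+1 k) ⟩
      qint k + (qint k * (q - 1#) + 1#)        ≈⟨ +-assoc _ _ _ ⟨
      (qint k + qint k * (q - 1#)) + 1#        ≈⟨ +-congʳ (+-congʳ (*-identityʳ (qint k))) ⟨
      (qint k * 1# + qint k * (q - 1#)) + 1#   ≈⟨ +-congʳ (distribˡ (qint k) 1# (q - 1#)) ⟨
      qint k * (1# + (q - 1#)) + 1#            ≈⟨ +-congʳ (*-congˡ (trans (+-comm _ _) q-1+1≈q)) ⟩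
      qint k * q + 1#                          ∎

  open Ring A
  open SetoidReasoning setoid
  open NoncommutativeRing A

  Central : Set (c ⊔ c' ⊔ ℓ')
  Central = ∀ k x → Commute (ι k) x

  QuadraticRelation FarCommutation BraidRelation : ℕ → Set ℓ'
  QuadraticRelation n = ∀ i → 1 ≤ i → i < n → T i * T i ≈ ι (q K.- K.1#) * T i + ι q
  FarCommutation n = ∀ i j → 1 ≤ i → i < n → 1 ≤ j → j < n → 2 ≤ ∣ i - j ∣ → Commute (T i) (T j)
  BraidRelation n = ∀ i → 1 ≤ i → suc i < n → (T i * T (suc i)) * T i ≈ (T (suc i) * T i) * T (suc i)

  sum1-cong : ∀ m {f g : ℕ → Carrier} → (∀ i → 1 ≤ i → i ≤ m → f i ≈ g i) → sum1 m f ≈ sum1 m g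
  sum1-cong zero    f≈g = refl
  sum1-cong (suc m) f≈g =
    +-cong (sum1-cong m (λ i 1≤i i≤m → f≈g i 1≤i (ℕ.m≤n⇒m≤1+n i≤m))) (f≈g (suc m) (s≤s z≤n) ℕ.≤-refl)

  sum1-distribˡ : ∀ m x (f : ℕ → Carrier) → x * sum1 m f ≈ sum1 m (λ i → x * f i)
  sum1-distribˡ zero    x f = zeroʳ x
  sum1-distribˡ (suc m) x f = trans (distribˡ x _ _) (+-congʳ (sum1-distribˡ m x f))

  sum1-distribʳ : ∀ m x (f : ℕ → Carrier) → sum1 m f * x ≈ sum1 m (λ i → f i * x)
  sum1-distribʳ zero    x f = zeroˡ x
  sum1-distribʳ (suc m) x f = trans (distribʳ x _ _) (+-congʳ (sum1-distribʳ m x f))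

  asc-snoc : ∀ i k → asc i (suc k) ≈ asc i k * T (i +ℕ k)
  asc-snoc i zero    = trans (*-identityʳ (T i))
    (trans (reflexive (≡.cong T (≡.sym (ℕ.+-identityʳ i)))) (sym (*-identityˡ _)))
  asc-snoc i (suc k) = begin
    T i * asc (suc i) (suc k)                 ≈⟨ *-congˡ (asc-snoc (suc i) k) ⟩
    T i * (asc (suc i) k * T (suc i +ℕ k))    ≈⟨ *-assoc _ _ _ ⟨
    (T i * asc (suc i) k) * T (suc i +ℕ k)    ≡⟨ ≡.cong (λ j → asc i (suc k) * T j) (ℕ.+-suc i k) ⟨
    asc i (suc k) * T (i +ℕ suc k)            ∎

  desc-extend : ∀ {i m} → i ≤ m → desc i (suc m ∸ i) ≡ T m * desc i (m ∸ i)
  desc-extend {i} {m} i≤m rewrite ℕ.+-∸-assoc 1 i≤m | ℕ.m+[n∸m]≡n i≤m = ≡.refl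

  asc-extend : ∀ {i m} → i ≤ m → asc i (suc m ∸ i) ≈ asc i (m ∸ i) * T m
  asc-extend {i} {m} i≤m rewrite ℕ.+-∸-assoc 1 i≤m =
    trans (asc-snoc i (m ∸ i)) (*-congˡ (reflexive (≡.cong T (ℕ.m+[n∸m]≡n i≤m))))

  B-suc : ∀ m → B (suc m) ≈ T m * B m + 1#
  B-suc m = +-cong
    (trans (sum1-cong m (λ i _ i≤m → reflexive (desc-extend i≤m))) (sym (sum1-distribˡ m (T m) _)))
    (reflexive (≡.cong (desc (suc m)) (ℕ.n∸n≡0 m)))

  B*-suc : ∀ m → B* (suc m) ≈ B* m * T m + 1#
  B*-suc m = +-cong
    (trans (sum1-cong m (λ i _ i≤m → asc-extend i≤m)) (sym (sum1-distribʳ m (T m) _)))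
    (reflexive (≡.cong (asc (suc m)) (ℕ.n∸n≡0 m)))

  B-one : B 1 ≈ 1#
  B-one = +-identityˡ 1#

  B*-one : B* 1 ≈ 1#
  B*-one = +-identityˡ 1#

  module _ (hom : IsRingHomomorphism K.rawRing rawRing ι) (central : Central)
           (n : ℕ) (quad : QuadraticRelation n) (comm : FarCommutation n) (braid : BraidRelation n)
           where

    open IsRingHomomorphism hom using (⟦⟧-cong; +-homo; *-homo; 1#-homo)
    open RingProperties A using (+-cancelʳ)
    module +-Solver = CommutativeMonoidSolver +-commutativeMonoid
    open +-Solver using (_⊕_; _⊜_)

    ι-+1# : ∀ x → ι (x K.+ K.1#) ≈ ι x + 1#
    ι-+1# x = trans (+-homo x K.1#) (+-congˡ 1#-homo)

    ι-+1#-distribʳ : ∀ x u → ι (x K.+ K.1#) * u ≈ ι x * u + u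
    ι-+1#-distribʳ x u = begin
      ι (x K.+ K.1#) * u ≈⟨ *-congʳ (ι-+1# x) ⟩
      (ι x + 1#) * u     ≈⟨ distribʳ u (ι x) 1# ⟩
      ι x * u + 1# * u   ≈⟨ +-congˡ (*-identityˡ u) ⟩
      ι x * u + u        ∎

    quadratic⇒eigen : ∀ {u} → u * u ≈ ι (q K.- K.1#) * u + ι q → u * (u + 1#) ≈ ι q * (u + 1#)
    quadratic⇒eigen {u} u²≈ = begin
      u * (u + 1#)                        ≈⟨ trans (distribˡ u u 1#) (+-cong u²≈ (*-identityʳ u)) ⟩
      (ι (q K.- K.1#) * u + ι q) + u      ≈⟨ xy∙z≈xz∙y _ _ _ ⟩
      (ι (q K.- K.1#) * u + u) + ι q      ≈⟨ +-congʳ (ι-+1#-distribʳ (q K.- K.1#) u) ⟨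
      ι ((q K.- K.1#) K.+ K.1#) * u + ι q ≈⟨ +-cong (*-congʳ (⟦⟧-cong (K.sym q-1+1≈q))) (*-identityʳ (ι q)) ⟨
      ι q * u + ι q * 1#                  ≈⟨ distribˡ (ι q) u 1# ⟨
      ι q * (u + 1#)                      ∎
      where open CommutativeSemigroupProperties +-commutativeSemigroup using (xy∙z≈xz∙y)

    quadratic-conj-qint : ∀ {u} k → u * u ≈ ι (q K.- K.1#) * u + ι q →
      (u * ι (qint k)) * u + (u + 1#) ≈ ι (qpow k) * u + ι (qint (suc k))
    quadratic-conj-qint {u} k u²≈ = begin
      (u * ι [k]) * u + (u + 1#)
        ≈⟨ +-congʳ (trans (*-congʳ (sym (central [k] u))) (*-assoc _ _ _)) ⟩
      ι [k] * (u * u) + (u + 1#)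
        ≈⟨ +-congʳ (trans (*-congˡ u²≈) (distribˡ _ _ _)) ⟩
      (ι [k] * (ι (q K.- K.1#) * u) + ι [k] * ι q) + (u + 1#)
        ≈⟨ +-congʳ (+-cong (trans (*-congʳ (*-homo _ _)) (*-assoc _ _ _)) (*-homo _ _)) ⟨
      (ι ([k] K.* (q K.- K.1#)) * u + ι ([k] K.* q)) + (u + 1#)
        ≈⟨ interchange _ _ _ _ ⟩
      (ι ([k] K.* (q K.- K.1#)) * u + u) + (ι ([k] K.* q) + 1#)
        ≈⟨ +-cong (ι-+1#-distribʳ _ u) (ι-+1# _) ⟨
      ι ([k] K.* (q K.- K.1#) K.+ K.1#) * u + ι ([k] K.* q K.+ K.1#)
        ≈⟨ +-cong (*-congʳ (⟦⟧-cong (qpow≈qint*[q-1]+1 k))) (⟦⟧-cong (qint-suc≈qint*q+1 k)) ⟨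
      ι (qpow k) * u + ι (qint (suc k)) ∎
      where
      [k] : K.Carrier
      [k] = qint k
      open CommutativeSemigroupProperties +-commutativeSemigroup using (interchange)

    T-commute : ∀ i j → 1 ≤ i → suc i < j → j < n → Commute (T j) (T i)
    T-commute i j 1≤i i+1<j j<n = comm j i 1≤j j<n 1≤i i<n 2≤∣j-i∣
      where
      i≤j : i ≤ j
      i≤j = ℕ.<⇒≤ (ℕ.<-trans (ℕ.n<1+n i) i+1<j)
      1≤j : 1 ≤ j
      1≤j = ℕ.≤-trans 1≤i i≤j
      i<n : i < n
      i<n = ℕ.≤-trans (ℕ.<⇒≤ i+1<j) (ℕ.<⇒≤ j<n)
      2≤∣j-i∣ : 2 ≤ ∣ j - i ∣
      2≤∣j-i∣ = ≡.subst (2 ≤_) (≡.sym (ℕ.m≤n⇒∣n-m∣≡n∸m i≤j)) (ℕ.m+n≤o⇒m≤o∸n 2 i+1<j)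

    B-commute : ∀ k j → k < j → j < n → Commute (T j) (B k)
    B-commute zero          j _       _   = commute-0# (T j)
    B-commute (suc zero)    j _       _   = commute-respʳ (sym B-one) (commute-1# (T j))
    B-commute (suc (suc k)) j k+2<j j<n = commute-respʳ (sym (B-suc (suc k)))
      (commute-+ (commute-* (T-commute (suc k) j (s≤s z≤n) k+2<j j<n)
                            (B-commute (suc k) j (ℕ.<⇒≤ k+2<j) j<n))
                 (commute-1# (T j)))

    B*-commute : ∀ k j → k < j → j < n → Commute (T j) (B* k)
    B*-commute zero          j _       _   = commute-0# (T j)
    B*-commute (suc zero)    j _       _   = commute-respʳ (sym B*-one) (commute-1# (T j))
    B*-commute (suc (suc k)) j k+2<j j<n = commute-respʳ (sym (B*-suc (suc k)))
      (commute-+ (commute-* (B*-commute (suc k) j (ℕ.<⇒≤ k+2<j) j<n)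
                            (T-commute (suc k) j (s≤s z≤n) k+2<j j<n))
                 (commute-1# (T j)))

    asc-commute : ∀ k i p → 1 ≤ i → i +ℕ k < p → p < n → Commute (T p) (asc i k)
    asc-commute zero    i p _   _   _   = commute-1# (T p)
    asc-commute (suc k) i p 1≤i i+k+1<p p<n =
      commute-* (T-commute i p 1≤i (ℕ.≤-trans (s≤s (s≤s (ℕ.m≤m+n i k))) i+k<p′) p<n)
                (asc-commute k (suc i) p (s≤s z≤n) i+k<p′ p<n)
      where
      i+k<p′ : suc (i +ℕ k) < p
      i+k<p′ = ≡.subst (_< p) (ℕ.+-suc i k) i+k+1<p

    desc-commute : ∀ k i p → 1 ≤ i → i +ℕ k < p → p < n → Commute (T p) (desc i k)
    desc-commute zero    i p _   _   _   = commute-1# (T p)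
    desc-commute (suc k) i p 1≤i i+k+1<p p<n =
      commute-* (T-commute (i +ℕ k) p (ℕ.≤-trans 1≤i (ℕ.m≤m+n i k)) i+k<p′ p<n)
                (desc-commute k i p 1≤i (ℕ.<⇒≤ i+k<p′) p<n)
      where
      i+k<p′ : suc (i +ℕ k) < p
      i+k<p′ = ≡.subst (_< p) (ℕ.+-suc i k) i+k+1<p

    B*-braid : ∀ p → suc p < n →
      B* p * ((T p * T (suc p)) * T p) ≈ B* p * ((T (suc p) * T p) * T (suc p))
    B*-braid zero    _       = trans (zeroˡ _) (sym (zeroˡ _))
    B*-braid (suc p) p+2<n = *-congˡ (braid (suc p) (s≤s z≤n) p+2<n)

    Ttrans-suc : ∀ {i p} → 1 ≤ i → i ≤ p → suc p < n →
      Ttrans i (suc (suc p)) ≈ (T (suc p) * Ttrans i (suc p)) * T (suc p)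
    Ttrans-suc {i} {p} 1≤i i≤p p+1<n rewrite ℕ.+-∸-assoc 1 i≤p =
      conjugate (ℕ.m+[n∸m]≡n i≤p)
      where
      conjugate : ∀ {k} → i +ℕ k ≡ p →
        (asc i (suc k) * T (suc p)) * desc i (suc k) ≈ (T (suc p) * ((asc i k * T p) * desc i k)) * T (suc p)
      conjugate {k} ≡.refl = trans (*-congʳ (*-congʳ (asc-snoc i k)))
        (braid-sandwich (asc-commute k i _ 1≤i ℕ.≤-refl p+1<n) (desc-commute k i _ 1≤i ℕ.≤-refl p+1<n)
                        (*-congˡ (braid (i +ℕ k) (ℕ.≤-trans 1≤i (ℕ.m≤m+n i k)) p+1<n)))

    qnJ-suc : ∀ p → suc p < n →
      qnJ (suc (suc p)) ≈ (T (suc p) * qnJ (suc p)) * T (suc p) + ι (qpow (suc p)) * T (suc p)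
    qnJ-suc p p+1<n = +-cong conjugated-terms (*-congˡ last-term)
      where
      u : Carrier
      u = T (suc p)
      move-scalar : ∀ k x → ι k * ((u * x) * u) ≈ (u * (ι k * x)) * u
      move-scalar k x = begin
        ι k * ((u * x) * u)  ≈⟨ *-assoc _ _ _ ⟨
        (ι k * (u * x)) * u  ≈⟨ *-congʳ (commute-swap x (central k u)) ⟩
        (u * (ι k * x)) * u  ∎
      conjugated-terms : sum1 p (λ i → ι (qpow i) * Ttrans i (suc (suc p))) ≈ (u * qnJ (suc p)) * u
      conjugated-terms = begin
        sum1 p (λ i → ι (qpow i) * Ttrans i (suc (suc p)))
          ≈⟨ sum1-cong p (λ i 1≤i i≤p → trans (*-congˡ (Ttrans-suc 1≤i i≤p p+1<n)) (move-scalar _ _)) ⟩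
        sum1 p (λ i → (u * (ι (qpow i) * Ttrans i (suc p))) * u)
          ≈⟨ sum1-distribʳ p u _ ⟨
        sum1 p (λ i → u * (ι (qpow i) * Ttrans i (suc p))) * u
          ≈⟨ *-congʳ (sum1-distribˡ p u _) ⟨
        (u * qnJ (suc p)) * u ∎
      last-term : Ttrans (suc p) (suc (suc p)) ≈ u
      last-term rewrite ℕ.n∸n≡0 p = trans (*-congʳ (*-identityˡ u)) (*-identityʳ u)

    T-BBsuc≈q-BBsuc : ∀ m → m < n → T m * (B m * B (suc m)) ≈ ι q * (B m * B (suc m))
    T-BBsuc≈q-BBsuc zero _ = trans (*-congˡ (zeroˡ _)) (trans (zeroʳ _) (sym (trans (*-congˡ (zeroˡ _)) (zeroʳ _))))
    T-BBsuc≈q-BBsuc (suc zero) 1<n = begin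
      T 1 * (B 1 * B 2)  ≈⟨ *-congˡ B1B2≈T1+1 ⟩
      T 1 * (T 1 + 1#)   ≈⟨ quadratic⇒eigen (quad 1 ℕ.≤-refl 1<n) ⟩
      ι q * (T 1 + 1#)   ≈⟨ *-congˡ B1B2≈T1+1 ⟨
      ι q * (B 1 * B 2)  ∎
      where
      B1B2≈T1+1 : B 1 * B 2 ≈ T 1 + 1#
      B1B2≈T1+1 = trans (*-cong B-one (trans (B-suc 1) (+-congʳ (trans (*-congˡ B-one) (*-identityʳ _)))))
                        (*-identityˡ _)
    T-BBsuc≈q-BBsuc (suc (suc r)) m<n = begin
      U * (B m * B (suc m))                      ≈⟨ *-congˡ expand ⟩
      U * ((V * U) * Y + (U + 1#) * B m)         ≈⟨ distribˡ _ _ _ ⟩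
      U * ((V * U) * Y) + U * ((U + 1#) * B m)   ≈⟨ +-cong (braided (T-BBsuc≈q-BBsuc (suc r) (ℕ.<⇒≤ m<n))) eigen ⟩
      ι q * ((V * U) * Y) + ι q * ((U + 1#) * B m) ≈⟨ distribˡ _ _ _ ⟨
      ι q * ((V * U) * Y + (U + 1#) * B m)       ≈⟨ *-congˡ expand ⟨
      ι q * (B m * B (suc m))                    ∎
      where
      m : ℕ
      m = suc (suc r)
      U V P Y : Carrier
      U = T m
      V = T (suc r)
      P = B (suc r)
      Y = P * B m
      swap-U-P : (V * P) * (U * B m) ≈ (V * U) * Y
      swap-U-P = begin
        (V * P) * (U * B m)  ≈⟨ solve *-monoid ⟩
        V * ((P * U) * B m)  ≈⟨ *-congˡ (*-congʳ (sym (B-commute (suc r) m ℕ.≤-refl m<n))) ⟩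
        V * ((U * P) * B m)  ≈⟨ solve *-monoid ⟩
        (V * U) * Y          ∎
      expand : B m * B (suc m) ≈ (V * U) * Y + (U + 1#) * B m
      expand = begin
        B m * B (suc m)
          ≈⟨ *-congˡ (B-suc m) ⟩
        B m * (U * B m + 1#)
          ≈⟨ trans (distribˡ _ _ _) (+-congˡ (*-identityʳ _)) ⟩
        B m * (U * B m) + B m
          ≈⟨ +-congʳ (trans (*-congʳ (B-suc (suc r))) (distribʳ _ _ _)) ⟩
        ((V * P) * (U * B m) + 1# * (U * B m)) + B m
          ≈⟨ +-congʳ (+-cong swap-U-P (*-identityˡ _)) ⟩
        ((V * U) * Y + U * B m) + B m
          ≈⟨ +-assoc _ _ _ ⟩
        (V * U) * Y + (U * B m + B m)
          ≈⟨ +-congˡ (trans (distribʳ _ _ _) (+-congˡ (*-identityˡ _))) ⟨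
        (V * U) * Y + (U + 1#) * B m ∎
      eigen : U * ((U + 1#) * B m) ≈ ι q * ((U + 1#) * B m)
      eigen = trans (sym (*-assoc _ _ _))
        (trans (*-congʳ (quadratic⇒eigen (quad m (s≤s z≤n) m<n))) (*-assoc _ _ _))
      braided : V * Y ≈ ι q * Y → U * ((V * U) * Y) ≈ ι q * ((V * U) * Y)
      braided VY≈qY = begin
        U * ((V * U) * Y)    ≈⟨ solve *-monoid ⟩
        ((U * V) * U) * Y    ≈⟨ *-congʳ (braid (suc r) (s≤s z≤n) m<n) ⟨
        ((V * U) * V) * Y    ≈⟨ *-assoc _ _ _ ⟩
        (V * U) * (V * Y)    ≈⟨ *-congˡ VY≈qY ⟩
        (V * U) * (ι q * Y)  ≈⟨ commute-swap Y (sym (central q (V * U))) ⟩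
        ι q * ((V * U) * Y)  ∎

    Bsuc-B*suc : ∀ m → m < n →
      B (suc m) * B* (suc m) ≈ (ι (qint (suc m)) + qnJ (suc m)) + (B* m * T m) * B m
    Bsuc-B*suc zero _ = begin
      B 1 * B* 1                         ≈⟨ trans (*-cong B-one B*-one) (*-identityˡ 1#) ⟩
      1#                                 ≈⟨ trans (⟦⟧-cong (K.+-identityˡ K.1#)) 1#-homo ⟨
      ι (qint 1)                         ≈⟨ trans (+-cong (+-identityʳ _) (zeroʳ _)) (+-identityʳ _) ⟨
      (ι (qint 1) + 0#) + (B* 0 * T 0) * 0# ∎
    -- Both sides are compared after adding t: B*_m t B_m + t expands without subtraction.
    Bsuc-B*suc (suc p) m<n = +-cancelʳ t _ _ (trans lhs (sym rhs))
      where
      m : ℕ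
      m = suc p
      t s E J W X : Carrier
      t = T m
      s = T p
      E = t * B m + B* m * t
      J = (t * qnJ m) * t
      W = (B* p * s) * B p
      X = ((B* p * s) * t) * (s * B p)
      braided : (t * W) * t ≈ X
      braided = sym (braid-sandwich (B*-commute p m ℕ.≤-refl m<n) (B-commute p m ℕ.≤-refl m<n) (B*-braid p m<n))
      lhs : B (suc m) * B* (suc m) + t ≈ (ι (qpow m) * t + ι (qint (suc m))) + (J + (X + E))
      lhs = begin
        B (suc m) * B* (suc m) + t
          ≈⟨ +-congʳ (trans (*-cong (B-suc m) (B*-suc m)) (+1-product-expansion t (B* m) (B m))) ⟩
        (((t * (B m * B* m)) * t + E) + 1#) + t
          ≈⟨ +-congʳ (+-congʳ (+-congʳ (*-congʳ (*-congˡ (Bsuc-B*suc p (ℕ.<⇒≤ m<n)))))) ⟩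
        (((t * ((ι (qint m) + qnJ m) + W)) * t + E) + 1#) + t
          ≈⟨ +-congʳ (+-congʳ (+-congʳ (trans (sandwich-distrib t _ W) (+-cong (sandwich-distrib t _ _) braided)))) ⟩
        (((((t * ι (qint m)) * t + J) + X) + E) + 1#) + t
          ≈⟨ +-Solver.solve 6 (λ a j x e o u → ((((a ⊕ j) ⊕ x) ⊕ e) ⊕ o) ⊕ u ⊜ (a ⊕ (u ⊕ o)) ⊕ (j ⊕ (x ⊕ e))) refl
               ((t * ι (qint m)) * t) J X E 1# t ⟩
        ((t * ι (qint m)) * t + (t + 1#)) + (J + (X + E))
          ≈⟨ +-congʳ (quadratic-conj-qint m (quad m (s≤s z≤n) m<n)) ⟩
        (ι (qpow m) * t + ι (qint (suc m))) + (J + (X + E)) ∎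
      B*tB+t : (B* m * t) * B m + t ≈ X + E
      B*tB+t = begin
        (B* m * t) * B m + t
          ≈⟨ +-congʳ (*-cong (*-congʳ (B*-suc p)) (B-suc p)) ⟩
        ((B* p * s + 1#) * t) * (s * B p + 1#) + t
          ≈⟨ +1-sandwich-expansion t _ _ ⟩
        X + (t * (s * B p + 1#) + (B* p * s + 1#) * t)
          ≈⟨ +-congˡ (+-cong (*-congˡ (B-suc p)) (*-congʳ (B*-suc p))) ⟨
        X + E ∎
      rhs : ((ι (qint (suc m)) + qnJ (suc m)) + (B* m * t) * B m) + t
            ≈ (ι (qpow m) * t + ι (qint (suc m))) + (J + (X + E))
      rhs = begin
        ((ι (qint (suc m)) + qnJ (suc m)) + (B* m * t) * B m) + t
          ≈⟨ +-assoc _ _ _ ⟩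
        (ι (qint (suc m)) + qnJ (suc m)) + ((B* m * t) * B m + t)
          ≈⟨ +-cong (+-congˡ (qnJ-suc p m<n)) B*tB+t ⟩
        (ι (qint (suc m)) + (J + ι (qpow m) * t)) + (X + E)
          ≈⟨ +-Solver.solve 5 (λ a j d x e → (a ⊕ (j ⊕ d)) ⊕ (x ⊕ e) ⊜ (d ⊕ a) ⊕ (j ⊕ (x ⊕ e))) refl
               (ι (qint (suc m))) J (ι (qpow m) * t) X E ⟩
        (ι (qpow m) * t + ι (qint (suc m))) + (J + (X + E)) ∎

    B-R-identity : ∀ m → m < n →
      B (suc m) * R (suc m) ≈ ((ι q * R m + ι (qint (suc m))) + qnJ (suc m)) * B (suc m)
    B-R-identity m m<n = begin
      B′ * (B* (suc m) * B′)           ≈⟨ *-assoc _ _ _ ⟨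
      (B′ * B* (suc m)) * B′           ≈⟨ *-congʳ (Bsuc-B*suc m m<n) ⟩
      (S + (B* m * T m) * B m) * B′    ≈⟨ distribʳ _ _ _ ⟩
      S * B′ + ((B* m * T m) * B m) * B′ ≈⟨ +-congˡ absorbed ⟩
      S * B′ + (ι q * R m) * B′        ≈⟨ trans (+-comm _ _) (sym (distribʳ _ _ _)) ⟩
      (ι q * R m + S) * B′             ≈⟨ *-congʳ (+-assoc _ _ _) ⟨
      ((ι q * R m + ι (qint (suc m))) + qnJ (suc m)) * B′ ∎
      where
      B′ S : Carrier
      B′ = B (suc m)
      S = ι (qint (suc m)) + qnJ (suc m)
      absorbed : ((B* m * T m) * B m) * B′ ≈ (ι q * R m) * B′
      absorbed = begin
        ((B* m * T m) * B m) * B′    ≈⟨ solve *-monoid ⟩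
        B* m * (T m * (B m * B′))    ≈⟨ *-congˡ (T-BBsuc≈q-BBsuc m m<n) ⟩
        B* m * (ι q * (B m * B′))    ≈⟨ commute-swap _ (sym (central q (B* m))) ⟩
        ι q * (B* m * (B m * B′))    ≈⟨ solve *-monoid ⟩
        (ι q * (B* m * B m)) * B′    ∎

theorem1p6 : ∀ {c ℓ c' ℓ' : Level} (K : CommutativeRing c ℓ) (A : Ring c' ℓ')
    (ι : CommutativeRing.Carrier K → Ring.Carrier A)
    → IsRingHomomorphism (CommutativeRing.rawRing K) (Ring.rawRing A) ι
    → (∀ k x → Ring._≈_ A (Ring._*_ A (ι k) x) (Ring._*_ A x (ι k)))
    → (q : CommutativeRing.Carrier K) (n : ℕ) → 1 ≤ n
    → (T : ℕ → Ring.Carrier A)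
    → (∀ i → 1 ≤ i → i < n →
         Ring._≈_ A (Ring._*_ A (T i) (T i))
           (Ring._+_ A (Ring._*_ A (ι (CommutativeRing._-_ K q (CommutativeRing.1# K))) (T i)) (ι q)))
    → (∀ i j → 1 ≤ i → i < n → 1 ≤ j → j < n → 2 ≤ ∣ i - j ∣ →
         Ring._≈_ A (Ring._*_ A (T i) (T j)) (Ring._*_ A (T j) (T i)))
    → (∀ i → 1 ≤ i → suc i < n →
         Ring._≈_ A (Ring._*_ A (Ring._*_ A (T i) (T (suc i))) (T i))
           (Ring._*_ A (Ring._*_ A (T (suc i)) (T i)) (T (suc i))))
    → let open Hecke K A ι q T
          open Ring A
      in B n * R n ≈ (ι q * R (n ∸ 1) + ι (qint n) + qnJ n) * B n
theorem1p6 K A ι hom central q (suc m) _ T quad comm braid =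
  HeckeProperties.B-R-identity K A ι q T hom central (suc m) quad comm braid m ℕ.≤-refl
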